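{- For every cathoristic logic formula $\phi$, $\mathrm{Simpl}(\phi)\models\phi$.
   Context: Fix a non-empty set $\Sigma$ of actions. Formulae: $\phi ::= \top \mid \phi\land\psi \mid \langle a\rangle\phi \mid\ !A$ with $a\in\Sigma$, $A$ a finite subset of $\Sigma$. A cathoristic transition system is $\mathcal{L}=(S,\rightarrow,\lambda)$ with $\rightarrow\subseteq S\times\Sigma\times S$ deterministic and $\lambda:S\to\mathcal{P}(\Sigma)$ such that $\{a\mid\exists t.\,s\xrightarrow{a}t\}\subseteq\lambda(s)$ and each $\lambda(s)$ is finite or $\Sigma$; a cathoristic model is $(\mathcal{L},s)$, $s\in S$. Satisfaction: $\top$ always; $\land$ componentwise; $(\mathcal{L},s)\models\langle a\rangle\phi$ iff some $s\xrightarrow{a}t$ has $(\mathcal{L},t)\models\phi$; $(\mathcal{L},s)\models\ !A$ iff $\lambda(s)\subseteq A$. A simulation from $(\mathcal{L}_1,s_1)$ to $(\mathcal{L}_2,s_2)$ is $R\subseteq S_1\times S_2$ containing $(s_1,s_2)$ such that whenever $(x,y)\in R$ and $x\xrightarrow{a}_1x'$ there is $y'$ with $y\xrightarrow{a}_2y'$, $(x',y')\in R$, and $\lambda_1(x)\supseteq\lambda_2(y)$ for all $(x,y)\in R$. $\mathfrak{M}\preceq\mathfrak{M}'$ iff there is a simulation from $\mathfrak{M}'$ to $\mathfrak{M}$; $\simeq$ is $\preceq\cap\preceq^{ -1}$. Models are considered up to $\simeq$, and a bottom element $\bot$ is added with $\bot\preceq\mathfrak{M}$ for all $\mathfrak{M}$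 and $\bot\models\phi$ for every formula $\phi$; the resulting ordered collection is a bounded lattice, and $\mathrm{glb}(\mathfrak{M},\mathfrak{M}')$ denotes the greatest lower bound of $\mathfrak{M},\mathfrak{M}'$ in it. $\mathrm{Simpl}$ is defined by recursion: $\mathrm{Simpl}(\top)=((\{v\},\emptyset,\{v\mapsto\Sigma\}),v)$; $\mathrm{Simpl}(!A)=((\{v\},\emptyset,\{v\mapsto A\}),v)$; $\mathrm{Simpl}(\phi_1\land\phi_2)=\mathrm{glb}(\mathrm{Simpl}(\phi_1),\mathrm{Simpl}(\phi_2))$; $\mathrm{Simpl}(\langle a\rangle\phi)=\bot$ if $\mathrm{Simpl}(\phi)=\bot$, and otherwise, if $\mathrm{Simpl}(\phi)=((S,\rightarrow,\lambda),w)$, then $\mathrm{Simpl}(\langle a\rangle\phi)=((S\cup\{w'\},\rightarrow\cup\{(w',a,w)\},\lambda\cup\{w'\mapsto\Sigma\}),w')$ for a fresh state $w'\notin S$. -}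

module Defs where

open import Data.Product using (Σ-syntax; _×_; _,_)
open import Data.Sum using (_⊎_; inj₁; inj₂)
open import Data.List using (List)
open import Data.List.Membership.Propositional using (_∈_)
open import Data.Maybe using (Maybe; just; nothing)
open import Data.Unit using (⊤; tt)
open import Data.Empty using (⊥)
open import Function.Bundles using (_⇔_)
open import Relation.Binary.PropositionalEquality using (_≡_; refl; cong)

module _ {Act : Set} where

  data Form : Set where
    ⊤ᶠ   : Form
    _∧ᶠ_ : Form → Form → Form
    ⟨_⟩_ : Act → Form → Form
    !_   : List Act → Form        -- !A with A a finite subset of Act

  -- Cathoristic transition systems.  lab s is the set λ(s) (as a predicate).
  record CTS : Set₁ where
    field
      St      : Set
      _⟶[_]_  : St → Act → St → Set
      lab     : St → Act → Set
      det     : ∀ {s a t t'} → s ⟶[ a ] t → s ⟶[ a ] t' → t ≡ t'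
      lab-out : ∀ {s a t} → s ⟶[ a ] t → lab s a
      lab-fin : ∀ s → (Σ[ L ∈ List Act ] (∀ a → lab s a ⇔ (a ∈ L)))
                      ⊎ (∀ a → lab s a)

  open CTS public

  record Model : Set₁ where
    constructor mkModel
    field
      sys   : CTS
      start : St sys

  open Model public

  Sat : (L : CTS) → St L → Form → Set
  Sat L s ⊤ᶠ = ⊤
  Sat L s (φ ∧ᶠ ψ) = Sat L s φ × Sat L s ψ
  Sat L s (⟨ a ⟩ φ) = Σ[ t ∈ St L ] (_⟶[_]_ L s a t × Sat L t φ)
  Sat L s (! A) = ∀ a → lab L s a → a ∈ A

  record Simulation (M₁ M₂ : Model) : Set₁ where
    field
      R      : St (sys M₁) → St (sys M₂) → Set
      R-init : R (start M₁) (start M₂)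
      R-step : ∀ {x y a x'} → R x y → _⟶[_]_ (sys M₁) x a x' →
               Σ[ y' ∈ St (sys M₂) ] (_⟶[_]_ (sys M₂) y a y' × R x' y')
      R-lab  : ∀ {x y} → R x y → ∀ a → lab (sys M₂) y a → lab (sys M₁) x a

  -- Models extended with a bottom element (nothing = ⊥).
  Model⊥ : Set₁
  Model⊥ = Maybe Model

  _⪯_ : Model⊥ → Model⊥ → Set₁
  nothing ⪯ _ = Data.Unit.Polymorphic.⊤
    where import Data.Unit.Polymorphic
  just M ⪯ nothing = Data.Empty.Polymorphic.⊥
    where import Data.Empty.Polymorphic
  just M ⪯ just M' = Simulation M' M

  _⊨_ : Model⊥ → Form → Set
  nothing ⊨ φ = ⊤
  just M ⊨ φ = Sat (sys M) (start M) φ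

  record IsGlb (g : Model⊥ → Model⊥ → Model⊥) : Set₁ where
    field
      lb₁      : ∀ m m' → g m m' ⪯ m
      lb₂      : ∀ m m' → g m m' ⪯ m'
      greatest : ∀ m m' n → n ⪯ m → n ⪯ m' → n ⪯ g m m'

  oneState : (l : Act → Set) →
             (∀ (s : ⊤) → (Σ[ L ∈ List Act ] (∀ a → l a ⇔ (a ∈ L))) ⊎ (∀ a → l a)) → Model
  oneState l fin = mkModel record
    { St = ⊤ ; _⟶[_]_ = λ _ _ _ → ⊥ ; lab = λ _ → l
    ; det = λ () ; lab-out = λ () ; lab-fin = fin } tt

  -- Transitions of the model with a fresh root w' and edge w' --a--> w.
  data Step (L : CTS) (a : Act) (w : St L) : Maybe (St L) → Act → Maybe (St L) → Set where
    old : ∀ {x b y} → _⟶[_]_ L x b y → Step L a w (just x) b (just y)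
    new : Step L a w nothing a (just w)

  extLab : (L : CTS) → Maybe (St L) → Act → Set
  extLab L (just x) = lab L x
  extLab L nothing = λ _ → ⊤

  extend : Act → Model → Model
  extend a (mkModel L w) = mkModel record
    { St = Maybe (St L) ; _⟶[_]_ = Step L a w ; lab = extLab L
    ; det = d ; lab-out = lo ; lab-fin = lf } nothing
    where
      d : ∀ {s b t t'} → Step L a w s b t → Step L a w s b t' → t ≡ t'
      d (old p) (old q) = cong just (det L p q)
      d new new = refl
      lo : ∀ {s b t} → Step L a w s b t → extLab L s b
      lo (old p) = lab-out L p
      lo new = tt
      lf : ∀ s → (Σ[ K ∈ List Act ] (∀ b → extLab L s b ⇔ (b ∈ K))) ⊎ (∀ b → extLab L s b)
      lf (just x) = lab-fin L x
      lf nothing = inj₂ (λ _ → tt)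

  Simpl : (Model⊥ → Model⊥ → Model⊥) → Form → Model⊥
  Simpl g ⊤ᶠ = just (oneState (λ _ → ⊤) (λ _ → inj₂ (λ _ → tt)))
  Simpl g (! A) = just (oneState (λ a → a ∈ A)
                    (λ _ → inj₁ (A , λ a → record { to = λ x → x ; from = λ x → x
                                                  ; to-cong = λ { refl → refl }
                                                  ; from-cong = λ { refl → refl } })))
  Simpl g (φ ∧ᶠ ψ) = g (Simpl g φ) (Simpl g ψ)
  Simpl g (⟨ a ⟩ φ) with Simpl g φ
  ... | nothing = nothing
  ... | just M = just (extend a M)

module Submission where

-- The proof is by induction on φ and rests on two general facts.
--  * Satisfaction is preserved along simulations (simulation-sound), hence
--    satisfaction on Model⊥ is downward closed for ⪯ (⪯-sound).  Since a
--    glb lies below both of its arguments, glb m m' satisfies φ ∧ ψ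
--    whenever m satisfies φ and m' satisfies ψ (glb-sound-∧).
--  * The old states of `extend a M` simulate the corresponding states of M
--    (extend-embedding); so the fresh root, whose a-edge leads to the old
--    start state, satisfies ⟨ a ⟩ φ whenever M satisfies φ (extend-sound).

open import Defs
open import Data.Product using (_,_)
open import Data.Maybe using (just; nothing)
open import Data.Unit using (tt)
open import Relation.Binary.PropositionalEquality using (_≡_; refl)

module _ {Act : Set} where

  simulation-sound : {M₁ M₂ : Model {Act}} (S : Simulation M₁ M₂) →
    ∀ {x y} → Simulation.R S x y → (φ : Form {Act}) →
    Sat (sys M₁) x φ → Sat (sys M₂) y φ
  simulation-sound S r ⊤ᶠ _ = tt
  simulation-sound S r (φ ∧ᶠ ψ) (sat-φ , sat-ψ) =
    simulation-sound S r φ sat-φ , simulation-sound S r ψ sat-ψ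
  simulation-sound S r (⟨ a ⟩ φ) (_ , x⟶x' , sat-φ) with Simulation.R-step S r x⟶x'
  ... | y' , y⟶y' , r' = y' , y⟶y' , simulation-sound S r' φ sat-φ
  simulation-sound S r (! A) sat-A a y-has-a = sat-A a (Simulation.R-lab S r a y-has-a)

  ⪯-sound : (m n : Model⊥ {Act}) → n ⪯ m → (φ : Form {Act}) → m ⊨ φ → n ⊨ φ
  ⪯-sound _ nothing _ _ _ = tt
  ⪯-sound (just M) (just N) S φ sat = simulation-sound S (Simulation.R-init S) φ sat

  glb-sound-∧ : {glb : Model⊥ {Act} → Model⊥ → Model⊥} → IsGlb glb →
    (m m' : Model⊥ {Act}) (φ ψ : Form {Act}) → m ⊨ φ → m' ⊨ ψ → glb m m' ⊨ (φ ∧ᶠ ψ)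
  glb-sound-∧ {glb} isGlb m m' φ ψ sat-φ sat-ψ with glb m m'
    | ⪯-sound m (glb m m') (IsGlb.lb₁ isGlb m m') φ sat-φ
    | ⪯-sound m' (glb m m') (IsGlb.lb₂ isGlb m m') ψ sat-ψ
  ... | nothing | _ | _ = tt
  ... | just _ | sat-φ' | sat-ψ' = sat-φ' , sat-ψ'

  extend-embedding : (a : Act) (M : Model {Act}) (x : St (sys M)) →
    Simulation (mkModel (sys M) x) (mkModel (sys (extend a M)) (just x))
  extend-embedding a M x = record
    { R      = λ u v → v ≡ just u
    ; R-init = refl
    ; R-step = λ { {x' = u'} refl u⟶u' → just u' , old u⟶u' , refl }
    ; R-lab  = λ { refl _ has-b → has-b }
    }

  extend-sound : (a : Act) (M : Model {Act}) (φ : Form {Act}) →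
    just M ⊨ φ → just (extend a M) ⊨ (⟨ a ⟩ φ)
  extend-sound a M φ sat =
    just (start M) , new ,
    simulation-sound (extend-embedding a M (start M)) refl φ sat

mainTheorem5 : {Act : Set} → Act →
    (glb : Model⊥ {Act} → Model⊥ → Model⊥) → IsGlb glb →
    (φ : Form {Act}) → Simpl glb φ ⊨ φ
mainTheorem5 _ glb isGlb ⊤ᶠ = tt
mainTheorem5 a₀ glb isGlb (φ ∧ᶠ ψ) =
  glb-sound-∧ isGlb (Simpl glb φ) (Simpl glb ψ) φ ψ
    (mainTheorem5 a₀ glb isGlb φ) (mainTheorem5 a₀ glb isGlb ψ)
mainTheorem5 a₀ glb isGlb (⟨ a ⟩ φ) with Simpl glb φ | mainTheorem5 a₀ glb isGlb φ
... | nothing | _   = tt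
... | just M  | sat = extend-sound a M φ sat
mainTheorem5 _ glb isGlb (! A) = λ _ a∈A → a∈A
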